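{- Let $t\in\{0,1,2\}$, let $F$ be a type $t$ forest on $n$ vertices, and let $\chi:E(K_{n+t})\to\mathbb{Z}_3$ be a coloring that contains no alternating $4$-cycle. Then $K_{n+t}$ contains a copy of $F$ whose edge colors sum to $0$ in $\mathbb{Z}_3$.
   Context: Let $F$ be a forest with $3\mid e(F)$ and no isolated vertices. $F$ is of type $2$ if every vertex has degree $\equiv 1 \pmod 3$ or $F$ is a star; of type $1$ if it is not of type $2$ and either no vertex has degree divisible by $3$, or exactly one vertex has degree $\equiv 0 \pmod 3$ and all others have degree $\equiv 1\pmod 3$; of type $0$ otherwise. For a coloring $\chi$ of the edges of a complete graph with $\mathbb{Z}_3$, a $4$-cycle is alternating if the sums of the colors on its two perfect matchings are distinct. A copy of $F$ is a subgraph isomorphic to $F$. -}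

module Defs where

open import Data.Nat using (ℕ; zero; suc; _+_; _<_; _≤_; _%_)
open import Data.Nat.Divisibility using (_∣_)
open import Data.Fin using (Fin; toℕ; inject₁; fromℕ) renaming (zero to fz; suc to fs)
open import Data.Bool using (Bool; true; false; if_then_else_)
open import Data.List using (List; map; allFin)
open import Data.Nat.ListAction using (sum)
open import Data.Product using (Σ; _×_; ∃)
open import Relation.Binary.PropositionalEquality using (_≡_; _≢_)
open import Relation.Nullary using (¬_)
open import Function.Definitions using (Injective)

record Graph (n : ℕ) : Set where
  field
    adj   : Fin n → Fin n → Bool
    sym   : ∀ u v → adj u v ≡ adj v u
    irrfl : ∀ v → adj v v ≡ false
open Graph public

Σv : {n : ℕ} → (Fin n → ℕ) → ℕ
Σv {n} f = sum (map f (allFin n))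

ind : Bool → ℕ
ind true  = 1
ind false = 0

degree : {n : ℕ} → Graph n → Fin n → ℕ
degree G v = Σv (λ w → ind (adj G v w))

edgeCount : {n : ℕ} → Graph n → ℕ
edgeCount G = Σv (λ u → Σv (λ v → if Data.Nat._<ᵇ_ (toℕ u) (toℕ v) then ind (adj G u v) else 0))
  where import Data.Nat

record Cycle {n : ℕ} (G : Graph n) : Set where
  field
    k    : ℕ
    vs   : Fin (suc (suc (suc k))) → Fin n
    inj  : Injective _≡_ _≡_ vs
    step : ∀ (i : Fin (suc (suc k))) → adj G (vs (inject₁ i)) (vs (fs i)) ≡ true
    close : adj G (vs (fromℕ (suc (suc k)))) (vs fz) ≡ true

IsForest : {n : ℕ} → Graph n → Set
IsForest G = ¬ Cycle G

NoIsolated : {n : ℕ} → Graph n → Set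
NoIsolated G = ∀ v → 1 ≤ degree G v

IsStar : {n : ℕ} → Graph n → Set
IsStar {n} G = Σ (Fin n) λ c →
  (∀ v → v ≢ c → adj G c v ≡ true) ×
  (∀ u v → adj G u v ≡ true → (u ≡ c) Data.Sum.⊎ (v ≡ c))
  where import Data.Sum

Type2 : {n : ℕ} → Graph n → Set
Type2 G = (∀ v → degree G v % 3 ≡ 1) Data.Sum.⊎ IsStar G
  where import Data.Sum

Type1Cond : {n : ℕ} → Graph n → Set
Type1Cond {n} G =
  (∀ v → degree G v % 3 ≢ 0) Data.Sum.⊎
  (Σ (Fin n) λ c → degree G c % 3 ≡ 0 × (∀ v → v ≢ c → degree G v % 3 ≡ 1))
  where import Data.Sum

HasType : {n : ℕ} → Graph n → Fin 3 → Set
HasType G fz           = ¬ Type2 G × ¬ Type1Cond G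
HasType G (fs fz)      = ¬ Type2 G × Type1Cond G
HasType G (fs (fs fz)) = Type2 G

-- ℤ₃ is represented by Fin 3; addition is addition of representatives mod 3.
-- An edge colouring of K_m: symmetric function on pairs (diagonal unused).
Coloring : ℕ → Set
Coloring m = Fin m → Fin m → Fin 3

IsEdgeColoring : {m : ℕ} → Coloring m → Set
IsEdgeColoring χ = ∀ u v → χ u v ≡ χ v u

-- 4-cycle a b c d a with perfect matchings {ab,cd} and {bc,da}
AlternatingC4 : {m : ℕ} → Coloring m → Fin m → Fin m → Fin m → Fin m → Set
AlternatingC4 χ a b c d =
  a ≢ b × a ≢ c × a ≢ d × b ≢ c × b ≢ d × c ≢ d ×
  ((toℕ (χ a b) + toℕ (χ c d)) % 3 ≢ (toℕ (χ b c) + toℕ (χ d a)) % 3)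

NoAlternatingC4 : {m : ℕ} → Coloring m → Set
NoAlternatingC4 χ = ∀ a b c d → ¬ AlternatingC4 χ a b c d

copyColorSum : {n m : ℕ} → Graph n → Coloring m → (Fin n → Fin m) → ℕ
copyColorSum G χ φ =
  Σv (λ u → Σv (λ v → if Data.Nat._<ᵇ_ (toℕ u) (toℕ v)
                        then (if adj G u v then toℕ (χ (φ u) (φ v)) else 0) else 0))
  where import Data.Nat

HasZeroSumCopy : {n m : ℕ} → Graph n → Coloring m → Set
HasZeroSumCopy {n} {m} G χ =
  Σ (Fin n → Fin m) λ φ → Injective _≡_ _≡_ φ × (copyColorSum G χ φ % 3 ≡ 0)

module Submission where

-- A ℤ₃-coloring of K_m without alternating 4-cycles is a sum coloring, χ(xy) = f(x) + f(y).
-- The color sum of a copy φ of F is then Σ_v deg(v) f(φ v).  Give the t added vertices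
-- weight 0 and every vertex v of F the weight W(v) = deg(v) mod 3, so that Σ W = 2 e(F) = 0;
-- a zero-sum copy is then a permutation π with S(π) = Σ_i W(i) f(π i) = 0.  Composing π with
-- the transposition (i j) changes S by -(W i - W j)(f i - f j).  If neither one transposition
-- nor two disjoint ones reach 0, the pairs that change S by S pairwise intersect, so they form
-- a star or a triangle.  Off the centre of a star W or f is constant, which forces S = 0 or a
-- transposition reaching 0 after all; the corners of a triangle pairwise differ both in W and
-- in f, so no fourth vertex agrees with each of them in W or in f.  Both cases are excluded
-- once W has two zeros or takes all three values with a fourth vertex to spare, and the type
-- of F provides exactly this, via the added vertices, a leaf of F and the neighbours of a
-- vertex of degree 0 or 2 mod 3.

open import Algebra.Bundles using (CommutativeMonoid; CommutativeRing)
open import Data.Bool using (Bool; true; false; if_then_else_; T)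
open import Data.Bool.Properties using (if-float; T-≡)
open import Data.Empty using (⊥)
open import Data.Fin using (Fin; zero; suc; toℕ; fromℕ<; fromℕ; inject₁; _↑ˡ_; _↑ʳ_; splitAt)
open import Data.Fin.Permutation as Perm using (Permutation′; _⟨$⟩ʳ_; _∘ₚ_)
import Data.Fin.Permutation.Components as PC
open import Data.Fin.Properties
  using ( _≟_; all?; any?; ¬∀⟶∃¬; pigeonhole; toℕ-injective; toℕ<n; toℕ-fromℕ<; toℕ-fromℕ
        ; toℕ-inject₁; suc-injective; ↑ˡ-injective; ↑ʳ-injective; splitAt-↑ˡ; splitAt-↑ʳ)
open import Data.List using (List; []; _∷_; map; filter; length; allFin; tabulate)
open import Data.List.Membership.Propositional using (_∈_)
open import Data.List.Membership.Propositional.Properties using (∈-filter⁻)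
open import Data.List.Properties using (map-tabulate)
open import Data.List.Relation.Unary.All using (_∷_)
open import Data.List.Relation.Unary.AllPairs using (_∷_)
open import Data.List.Relation.Unary.Any using (here; there)
open import Data.List.Relation.Unary.Unique.Propositional using (Unique)
open import Data.List.Relation.Unary.Unique.Propositional.Properties using (allFin⁺; filter⁺)
open import Data.Nat as ℕ using (ℕ; _+_; _%_; _≤_; _<_; _<ᵇ_; z≤n; s≤s)
open import Data.Nat.Divisibility using (_∣_; divides)
open import Data.Nat.DivMod using (m%n<n; %-distribˡ-+; m*n%n≡0)
open import Data.Nat.Induction using (<-rec)
import Data.Nat.ListAction as ℕ
import Data.Nat.Properties as ℕ
open import Data.Product using (∃; ∃₂; _×_; _,_; proj₁; proj₂)
open import Data.Sum using (_⊎_; inj₁; inj₂)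
open import Data.Unit using (⊤; tt)
open import Data.Vec.Functional using (_++_)
open import Data.Vec.Functional.Properties using (lookup-++ˡ; lookup-++ʳ)
open import Function using (_∘_; _∘′_; case_of_)
open import Function.Bundles using (Equivalence; Injection)
open import Function.Definitions using (Injective)
open import Function.Properties.Inverse using (↔⇒↣)
open import Level using (0ℓ)
open import Relation.Binary.Definitions using (DecidableEquality; tri<; tri≈; tri>)
open import Relation.Binary.PropositionalEquality
open import Relation.Nullary using (¬_; Dec; yes; no; contradiction)
open import Relation.Nullary.Decidable
  using (from-yes; T?; ¬?; _→-dec_; _⊎-dec_; _×-dec_; decidable-stable; dec-true; dec-false)

open import Defs hiding (sym)

module _ {m : ℕ} where

  avoid₁ : (P : Fin m → Set) {a b : Fin m} → a ≢ b → P a → P b →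
           ∀ x → ∃ λ e → P e × e ≢ x
  avoid₁ P {a} {b} a≢b pa pb x with a ≟ x
  ... | yes refl = b , pb , a≢b ∘ sym
  ... | no a≢x   = a , pa , a≢x

  avoid₂ : (P : Fin m → Set) {a b c : Fin m} → a ≢ b → a ≢ c → b ≢ c → P a → P b → P c →
           ∀ x y → ∃ λ e → P e × e ≢ x × e ≢ y
  avoid₂ P {a} a≢b a≢c b≢c pa pb pc x y with a ≟ x | a ≟ y
  ... | no a≢x   | no a≢y   = a , pa , a≢x , a≢y
  ... | yes refl | _        =
    let e , (pe , e≢x) , e≢y = avoid₁ (λ e → P e × e ≢ a) b≢c (pb , a≢b ∘ sym) (pc , a≢c ∘ sym) y
    in e , pe , e≢x , e≢y
  ... | no _     | yes refl =
    let e , (pe , e≢y) , e≢x = avoid₁ (λ e → P e × e ≢ a) b≢c (pb , a≢b ∘ sym) (pc , a≢c ∘ sym) x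
    in e , pe , e≢x , e≢y

  avoid₃ : (P : Fin m → Set) {a b c d : Fin m} →
           a ≢ b → a ≢ c → a ≢ d → b ≢ c → b ≢ d → c ≢ d → P a → P b → P c → P d →
           ∀ x y z → ∃ λ e → P e × e ≢ x × e ≢ y × e ≢ z
  avoid₃ P {a} a≢b a≢c a≢d b≢c b≢d c≢d pa pb pc pd x y z with a ≟ x | a ≟ y | a ≟ z
  ... | no a≢x   | no a≢y   | no a≢z   = a , pa , a≢x , a≢y , a≢z
  ... | yes refl | _        | _        =
    let e , (pe , e≢x) , e≢y , e≢z = avoid₂ (λ e → P e × e ≢ a) b≢c b≢d c≢d
          (pb , a≢b ∘ sym) (pc , a≢c ∘ sym) (pd , a≢d ∘ sym) y z
    in e , pe , e≢x , e≢y , e≢z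
  ... | no _     | yes refl | _        =
    let e , (pe , e≢y) , e≢x , e≢z = avoid₂ (λ e → P e × e ≢ a) b≢c b≢d c≢d
          (pb , a≢b ∘ sym) (pc , a≢c ∘ sym) (pd , a≢d ∘ sym) x z
    in e , pe , e≢x , e≢y , e≢z
  ... | no _     | no _     | yes refl =
    let e , (pe , e≢z) , e≢x , e≢y = avoid₂ (λ e → P e × e ≢ a) b≢c b≢d c≢d
          (pb , a≢b ∘ sym) (pc , a≢c ∘ sym) (pd , a≢d ∘ sym) x y
    in e , pe , e≢x , e≢y , e≢z

module FiniteSum {c ℓ} (M : CommutativeMonoid c ℓ) where

  open CommutativeMonoid M
    using (Carrier; _≈_; _∙_; ∙-congˡ; ∙-congʳ; identityˡ; identityʳ; assoc; comm)
    renaming (ε to 0#)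
  module M = CommutativeMonoid M
  open import Algebra.Properties.CommutativeMonoid.Sum M using (sum; sum-cong-≋; sum-replicate-zero)
  open import Relation.Binary.Reasoning.Setoid M.setoid

  sum-zero : ∀ {m} {g : Fin m → Carrier} → (∀ a → g a ≈ 0#) → sum g ≈ 0#
  sum-zero {m} g≈0 = M.trans (sum-cong-≋ g≈0) (sum-replicate-zero m)

  sum-splitAt : ∀ m {n} (g : Fin (m + n) → Carrier) →
                sum g ≈ sum (λ i → g (i ↑ˡ n)) ∙ sum (λ j → g (m ↑ʳ j))
  sum-splitAt ℕ.zero    g = M.sym (identityˡ _)
  sum-splitAt (ℕ.suc m) g = M.trans (∙-congˡ (sum-splitAt m (g ∘ suc))) (M.sym (assoc _ _ _))

  sum-supported₁ : ∀ {m} (g : Fin m → Carrier) i → (∀ a → a ≢ i → g a ≈ 0#) → sum g ≈ g i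
  sum-supported₁ g zero    g≈0 = begin
    g zero ∙ sum (g ∘ suc)  ≈⟨ ∙-congˡ (sum-zero (λ a → g≈0 (suc a) λ ())) ⟩
    g zero ∙ 0#             ≈⟨ identityʳ _ ⟩
    g zero                  ∎
  sum-supported₁ g (suc i) g≈0 = begin
    g zero ∙ sum (g ∘ suc)  ≈⟨ ∙-congʳ (g≈0 zero λ ()) ⟩
    0# ∙ sum (g ∘ suc)      ≈⟨ identityˡ _ ⟩
    sum (g ∘ suc)           ≈⟨ sum-supported₁ (g ∘ suc) i (λ a a≢i →
                                 g≈0 (suc a) (a≢i ∘′ suc-injective)) ⟩
    g (suc i)               ∎

  sum-supported₂ : ∀ {m} (g : Fin m → Carrier) {i j} → i ≢ j →
                   (∀ a → a ≢ i → a ≢ j → g a ≈ 0#) → sum g ≈ g i ∙ g j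
  sum-supported₂ g {zero}  {zero}  i≢j g≈0 = contradiction refl i≢j
  sum-supported₂ g {zero}  {suc j} i≢j g≈0 =
    ∙-congˡ (sum-supported₁ (g ∘ suc) j (λ a a≢j → g≈0 (suc a) (λ ()) (a≢j ∘′ suc-injective)))
  sum-supported₂ g {suc i} {zero}  i≢j g≈0 = M.trans
    (∙-congˡ (sum-supported₁ (g ∘ suc) i (λ a a≢i → g≈0 (suc a) (a≢i ∘′ suc-injective) (λ ()))))
    (comm _ _)
  sum-supported₂ g {suc i} {suc j} i≢j g≈0 = begin
    g zero ∙ sum (g ∘ suc)  ≈⟨ ∙-congʳ (g≈0 zero (λ ()) (λ ())) ⟩
    0# ∙ sum (g ∘ suc)      ≈⟨ identityˡ _ ⟩
    sum (g ∘ suc)           ≈⟨ sum-supported₂ (g ∘ suc) (i≢j ∘ cong suc) (λ a a≢i a≢j →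
                                 g≈0 (suc a) (a≢i ∘′ suc-injective) (a≢j ∘′ suc-injective)) ⟩
    g (suc i) ∙ g (suc j)   ∎

-- ℤ₃

ℤ₃ : Set
ℤ₃ = Fin 3

pattern 0₃ = zero
pattern 1₃ = suc zero
pattern 2₃ = suc (suc zero)

infixl 6 _+₃_ _-₃_
infixl 7 _*₃_
infix 8 -₃_

_+₃_ : ℤ₃ → ℤ₃ → ℤ₃
0₃ +₃ y  = y
1₃ +₃ 0₃ = 1₃
1₃ +₃ 1₃ = 2₃
1₃ +₃ 2₃ = 0₃
2₃ +₃ 0₃ = 2₃
2₃ +₃ 1₃ = 0₃
2₃ +₃ 2₃ = 1₃

-₃_ : ℤ₃ → ℤ₃
-₃ 0₃ = 0₃
-₃ 1₃ = 2₃
-₃ 2₃ = 1₃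

_-₃_ : ℤ₃ → ℤ₃ → ℤ₃
x -₃ y = x +₃ -₃ y

_*₃_ : ℤ₃ → ℤ₃ → ℤ₃
0₃ *₃ y = 0₃
1₃ *₃ y = y
2₃ *₃ y = -₃ y

+-*-commutativeRing : CommutativeRing 0ℓ 0ℓ
+-*-commutativeRing = record
  { Carrier = ℤ₃ ; _≈_ = _≡_ ; _+_ = _+₃_ ; _*_ = _*₃_ ; -_ = -₃_ ; 0# = 0₃ ; 1# = 1₃
  ; isCommutativeRing = record
    { isRing = record
      { +-isAbelianGroup = record
        { isGroup = record
          { isMonoid = record
            { isSemigroup = record
              { isMagma = record { isEquivalence = isEquivalence ; ∙-cong = cong₂ _+₃_ }
              ; assoc = from-yes (all? λ x → all? λ y → all? λ z → x +₃ y +₃ z ≟ x +₃ (y +₃ z)) }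
            ; identity = (λ _ → refl) , from-yes (all? λ x → x +₃ 0₃ ≟ x) }
          ; inverse = from-yes (all? λ x → (-₃ x) +₃ x ≟ 0₃) , from-yes (all? λ x → x -₃ x ≟ 0₃)
          ; ⁻¹-cong = cong (-₃_) }
        ; comm = from-yes (all? λ x → all? λ y → x +₃ y ≟ y +₃ x) }
      ; *-cong = cong₂ _*₃_
      ; *-assoc = from-yes (all? λ x → all? λ y → all? λ z → x *₃ y *₃ z ≟ x *₃ (y *₃ z))
      ; *-identity = (λ _ → refl) , from-yes (all? λ x → x *₃ 1₃ ≟ x)
      ; distrib = from-yes (all? λ x → all? λ y → all? λ z → x *₃ (y +₃ z) ≟ x *₃ y +₃ x *₃ z)
                , from-yes (all? λ x → all? λ y → all? λ z → (y +₃ z) *₃ x ≟ y *₃ x +₃ z *₃ x) }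
    ; *-comm = from-yes (all? λ x → all? λ y → x *₃ y ≟ y *₃ x) } }

open CommutativeRing +-*-commutativeRing
  using (semiring)
  renaming (+-comm to +₃-comm; +-identityʳ to +₃-identityʳ; *-identityʳ to *₃-identityʳ; zeroʳ to *₃-zeroʳ)

open FiniteSum (CommutativeRing.+-commutativeMonoid +-*-commutativeRing)
open import Algebra.Properties.Semiring.Sum semiring
  using (sum; sum-cong-≗; ∑-distrib-+; ∑-comm; *-distribʳ-sum)

x-x≡0 : ∀ x → x -₃ x ≡ 0₃
x-x≡0 = from-yes (all? λ x → x -₃ x ≟ 0₃)

x-y≡0⇒x≡y : ∀ x y → x -₃ y ≡ 0₃ → x ≡ y
x-y≡0⇒x≡y = from-yes (all? λ x → all? λ y → x -₃ y ≟ 0₃ →-dec x ≟ y)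

-x≡0⇒x≡0 : ∀ x → -₃ x ≡ 0₃ → x ≡ 0₃
-x≡0⇒x≡0 = from-yes (all? λ x → -₃ x ≟ 0₃ →-dec x ≟ 0₃)

x≡y+[x-y] : ∀ x y → x ≡ y +₃ (x -₃ y)
x≡y+[x-y] = from-yes (all? λ x → all? λ y → x ≟ y +₃ (x -₃ y))

x*y≡0⇒x≡0⊎y≡0 : ∀ x y → x *₃ y ≡ 0₃ → x ≡ 0₃ ⊎ y ≡ 0₃
x*y≡0⇒x≡0⊎y≡0 = from-yes (all? λ x → all? λ y → x *₃ y ≟ 0₃ →-dec (x ≟ 0₃ ⊎-dec y ≟ 0₃))

≢0≢1⇒≡2 : ∀ {x} → x ≢ 0₃ → x ≢ 1₃ → x ≡ 2₃
≢0≢1⇒≡2 {x} = from-yes (all? λ (x : ℤ₃) → ¬? (x ≟ 0₃) →-dec ¬? (x ≟ 1₃) →-dec x ≟ 2₃) x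

≢s⇒≡0⊎≡-s : ∀ {s x} → s ≢ 0₃ → x ≢ s → x ≡ 0₃ ⊎ x ≡ -₃ s
≢s⇒≡0⊎≡-s {s} {x} =
  from-yes (all? λ s → all? λ x → ¬? (s ≟ 0₃) →-dec ¬? (x ≟ s) →-dec (x ≟ 0₃ ⊎-dec x ≟ -₃ s)) s x

x-[-x]-[-x]≡0 : ∀ x → x -₃ -₃ x -₃ -₃ x ≡ 0₃
x-[-x]-[-x]≡0 = from-yes (all? λ x → x -₃ -₃ x -₃ -₃ x ≟ 0₃)

w*y≡w*c+w*[y-c] : ∀ w y c → w *₃ y ≡ w *₃ c +₃ w *₃ (y -₃ c)
w*y≡w*c+w*[y-c] = from-yes (all? λ w → all? λ y → all? λ c → w *₃ y ≟ w *₃ c +₃ w *₃ (y -₃ c))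

2[a+b-c]+2[a+c-b]≡a : ∀ a b c → 2₃ *₃ (a +₃ b -₃ c) +₃ 2₃ *₃ (a +₃ c -₃ b) ≡ a
2[a+b-c]+2[a+c-b]≡a =
  from-yes (all? λ a → all? λ b → all? λ c → 2₃ *₃ (a +₃ b -₃ c) +₃ 2₃ *₃ (a +₃ c -₃ b) ≟ a)

[a-b]*[c-d]≡[b-a]*[d-c] : ∀ a b c d → (a -₃ b) *₃ (c -₃ d) ≡ (b -₃ a) *₃ (d -₃ c)
[a-b]*[c-d]≡[b-a]*[d-c] = from-yes (all? λ a → all? λ b → all? λ c → all? λ d →
  (a -₃ b) *₃ (c -₃ d) ≟ (b -₃ a) *₃ (d -₃ c))

p+q≡r+s⇒a+p-r≡a+s-q : ∀ a p q r s → p +₃ q ≡ r +₃ s → a +₃ p -₃ r ≡ a +₃ s -₃ q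
p+q≡r+s⇒a+p-r≡a+s-q = from-yes (all? λ a → all? λ p → all? λ q → all? λ r → all? λ s →
  p +₃ q ≟ r +₃ s →-dec a +₃ p -₃ r ≟ a +₃ s -₃ q)

transposition-gain : ∀ wᵢ wⱼ a b →
  (wᵢ *₃ b -₃ wᵢ *₃ a) +₃ (wⱼ *₃ a -₃ wⱼ *₃ b) ≡ -₃ ((wᵢ -₃ wⱼ) *₃ (a -₃ b))
transposition-gain = from-yes (all? λ wᵢ → all? λ wⱼ → all? λ a → all? λ b →
  (wᵢ *₃ b -₃ wᵢ *₃ a) +₃ (wⱼ *₃ a -₃ wⱼ *₃ b) ≟ -₃ ((wᵢ -₃ wⱼ) *₃ (a -₃ b)))

toℕ-+₃ : ∀ x y → toℕ (x +₃ y) ≡ (toℕ x + toℕ y) % 3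
toℕ-+₃ = from-yes (all? λ x → all? λ y → toℕ (x +₃ y) ℕ.≟ (toℕ x + toℕ y) % 3)

[_]₃ : ℕ → ℤ₃
[ x ]₃ = fromℕ< (m%n<n x 3)

toℕ-[]₃ : ∀ x → toℕ [ x ]₃ ≡ x % 3
toℕ-[]₃ x = toℕ-fromℕ< (m%n<n x 3)

[toℕ]₃ : ∀ x → [ toℕ x ]₃ ≡ x
[toℕ]₃ = from-yes (all? λ x → [ toℕ x ]₃ ≟ x)

[]₃-+ : ∀ x y → [ x + y ]₃ ≡ [ x ]₃ +₃ [ y ]₃
[]₃-+ x y = toℕ-injective (begin
  toℕ [ x + y ]₃                 ≡⟨ toℕ-[]₃ (x + y) ⟩
  (x + y) % 3                    ≡⟨ %-distribˡ-+ x y 3 ⟩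
  (x % 3 + y % 3) % 3            ≡⟨ cong₂ (λ a b → (a + b) % 3) (toℕ-[]₃ x) (toℕ-[]₃ y) ⟨
  (toℕ [ x ]₃ + toℕ [ y ]₃) % 3  ≡⟨ toℕ-+₃ [ x ]₃ [ y ]₃ ⟨
  toℕ ([ x ]₃ +₃ [ y ]₃)         ∎)
  where open ≡-Reasoning

3∣⇒[]₃≡0 : ∀ {x} → 3 ∣ x → [ x ]₃ ≡ 0₃
3∣⇒[]₃≡0 (divides k refl) = toℕ-injective (trans (toℕ-[]₃ (k ℕ.* 3)) (m*n%n≡0 k 3))

[]₃≡⇒%3≡ : ∀ x {r} → [ x ]₃ ≡ r → x % 3 ≡ toℕ r
[]₃≡⇒%3≡ x eq = trans (sym (toℕ-[]₃ x)) (cong toℕ eq)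

%3≡⇒[]₃≡ : ∀ x {r} → x % 3 ≡ toℕ r → [ x ]₃ ≡ r
%3≡⇒[]₃≡ x eq = toℕ-injective (trans (toℕ-[]₃ x) eq)

[]₃≡2⇒2≤ : ∀ {x} → [ x ]₃ ≡ 2₃ → 2 ≤ x
[]₃≡2⇒2≤ {ℕ.suc (ℕ.suc x)} _ = s≤s (s≤s z≤n)

[]₃≡0⇒3≤ : ∀ {x} → 1 ≤ x → [ x ]₃ ≡ 0₃ → 3 ≤ x
[]₃≡0⇒3≤ {ℕ.suc (ℕ.suc (ℕ.suc x))} _ _ = s≤s (s≤s (s≤s z≤n))

[sum-tabulate]₃ : ∀ {n} (g : Fin n → ℕ) → [ ℕ.sum (tabulate g) ]₃ ≡ sum (λ v → [ g v ]₃)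
[sum-tabulate]₃ {ℕ.zero}  g = refl
[sum-tabulate]₃ {ℕ.suc n} g = trans ([]₃-+ (g zero) _) (cong ([ g zero ]₃ +₃_) ([sum-tabulate]₃ (g ∘ suc)))

[Σv]₃ : ∀ {n} (g : Fin n → ℕ) → [ Σv g ]₃ ≡ sum (λ v → [ g v ]₃)
[Σv]₃ g = trans (cong (λ xs → [ ℕ.sum xs ]₃) (map-tabulate (λ v → v) g)) ([sum-tabulate]₃ g)

-- Colorings without alternating 4-cycles

SumColoring : ∀ {m} → Coloring m → (Fin m → ℤ₃) → Set
SumColoring χ f = ∀ x y → x ≢ y → χ x y ≡ f x +₃ f y

-- For a sum coloring, apex χ u v w = 2 f(u) whatever v and w are.
apex : ∀ {m} → Coloring m → Fin m → Fin m → Fin m → ℤ₃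
apex χ u v w = χ u v +₃ χ u w -₃ χ v w

module _ {m : ℕ} {χ : Coloring m} (χ-sym : IsEdgeColoring χ) (no-alt : NoAlternatingC4 χ) where

  matchings-agree : ∀ {a b c d} → a ≢ b → a ≢ c → a ≢ d → b ≢ c → b ≢ d → c ≢ d →
                    χ a b +₃ χ c d ≡ χ b c +₃ χ d a
  matchings-agree {a} {b} {c} {d} a≢b a≢c a≢d b≢c b≢d c≢d = toℕ-injective (begin
    toℕ (χ a b +₃ χ c d)             ≡⟨ toℕ-+₃ (χ a b) (χ c d) ⟩
    (toℕ (χ a b) + toℕ (χ c d)) % 3  ≡⟨ decidable-stable (_ ℕ.≟ _) (λ ≢ →
                                          no-alt a b c d (a≢b , a≢c , a≢d , b≢c , b≢d , c≢d , ≢)) ⟩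
    (toℕ (χ b c) + toℕ (χ d a)) % 3  ≡⟨ toℕ-+₃ (χ b c) (χ d a) ⟨
    toℕ (χ b c +₃ χ d a)             ∎)
    where open ≡-Reasoning

  apex-swap : ∀ u v w → apex χ u v w ≡ apex χ u w v
  apex-swap u v w = cong₂ _-₃_ (+₃-comm (χ u v) (χ u w)) (χ-sym v w)

  apex-moveʳ : ∀ {u v w x} → u ≢ v → u ≢ w → v ≢ w → x ≢ u → x ≢ v → apex χ u v w ≡ apex χ u v x
  apex-moveʳ {u} {v} {w} {x} u≢v u≢w v≢w x≢u x≢v with x ≟ w
  ... | yes refl = refl
  ... | no x≢w   = p+q≡r+s⇒a+p-r≡a+s-q (χ u v) (χ u w) (χ v x) (χ v w) (χ u x) (begin
    χ u w +₃ χ v x  ≡⟨ matchings-agree u≢w u≢v (x≢u ∘ sym) (v≢w ∘ sym) (x≢w ∘ sym) (x≢v ∘ sym) ⟩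
    χ w v +₃ χ x u  ≡⟨ cong₂ _+₃_ (χ-sym w v) (χ-sym x u) ⟩
    χ v w +₃ χ u x  ∎)
    where open ≡-Reasoning

  apex-independent : ∀ {u v w v′ w′} → u ≢ v → u ≢ w → v ≢ w →
                     u ≢ v′ → u ≢ w′ → v′ ≢ w′ → apex χ u v w ≡ apex χ u v′ w′
  apex-independent {u} {v} {w} {v′} {w′} u≢v u≢w v≢w u≢v′ u≢w′ v′≢w′ with v′ ≟ w
  ... | yes refl =
    trans (apex-swap u v v′) (apex-moveʳ u≢v′ u≢v (v≢w ∘ sym) (u≢w′ ∘ sym) (v′≢w′ ∘ sym))
  ... | no v′≢w  = begin
    apex χ u v w    ≡⟨ apex-swap u v w ⟩
    apex χ u w v    ≡⟨ apex-moveʳ u≢w u≢v (v≢w ∘ sym) (u≢v′ ∘ sym) v′≢w ⟩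
    apex χ u w v′   ≡⟨ apex-swap u w v′ ⟩
    apex χ u v′ w   ≡⟨ apex-moveʳ u≢v′ u≢w v′≢w (u≢w′ ∘ sym) (v′≢w′ ∘ sym) ⟩
    apex χ u v′ w′  ∎
    where open ≡-Reasoning

two-others : ∀ {k} (u : Fin (3 + k)) → ∃₂ λ v w → u ≢ v × u ≢ w × v ≢ w
two-others zero          = suc zero , suc (suc zero) , (λ ()) , (λ ()) , (λ ())
two-others (suc zero)    = zero , suc (suc zero) , (λ ()) , (λ ()) , (λ ())
two-others (suc (suc u)) = zero , suc zero , (λ ()) , (λ ()) , (λ ())

sum-coloring : ∀ {m} {χ : Coloring m} → IsEdgeColoring χ → NoAlternatingC4 χ → ∃ (SumColoring χ)
sum-coloring {0} _ _ = (λ ()) , λ ()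
sum-coloring {1} _ _ = (λ _ → 0₃) , λ { zero zero 0≢0 → contradiction refl 0≢0 }
sum-coloring {2} {χ} χ-sym _ = f , χ≡f+f
  where
  f : Fin 2 → ℤ₃
  f zero       = χ zero (suc zero)
  f (suc zero) = 0₃
  χ≡f+f : SumColoring χ f
  χ≡f+f zero       zero       0≢0 = contradiction refl 0≢0
  χ≡f+f zero       (suc zero) _   = sym (+₃-identityʳ _)
  χ≡f+f (suc zero) zero       _   = χ-sym (suc zero) zero
  χ≡f+f (suc zero) (suc zero) 1≢1 = contradiction refl 1≢1
sum-coloring {ℕ.suc (ℕ.suc (ℕ.suc k))} {χ} χ-sym no-alt = f , χ≡f+f
  where
  f : Fin (3 + k) → ℤ₃
  f u = let v , w , _ = two-others u in 2₃ *₃ apex χ u v w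

  f≡2apex : ∀ {u v w} → u ≢ v → u ≢ w → v ≢ w → f u ≡ 2₃ *₃ apex χ u v w
  f≡2apex {u} u≢v u≢w v≢w = let _ , _ , u≢v′ , u≢w′ , v′≢w′ = two-others u in
    cong (2₃ *₃_) (apex-independent χ-sym no-alt u≢v′ u≢w′ v′≢w′ u≢v u≢w v≢w)

  χ≡f+f : SumColoring χ f
  χ≡f+f u x u≢x
    with y , _ , y≢u , y≢x ← avoid₂ (λ _ → ⊤) {zero} {suc zero} {suc (suc zero)}
                                    (λ ()) (λ ()) (λ ()) tt tt tt u x
    = sym (begin
    f u +₃ f x
      ≡⟨ cong₂ _+₃_ (f≡2apex u≢x (y≢u ∘ sym) (y≢x ∘ sym))
                    (f≡2apex (u≢x ∘ sym) (y≢x ∘ sym) (y≢u ∘ sym)) ⟩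
    2₃ *₃ apex χ u x y +₃ 2₃ *₃ apex χ x u y
      ≡⟨ cong (λ a → 2₃ *₃ apex χ u x y +₃ 2₃ *₃ (a +₃ χ x y -₃ χ u y)) (χ-sym x u) ⟩
    2₃ *₃ (χ u x +₃ χ u y -₃ χ x y) +₃ 2₃ *₃ (χ u x +₃ χ x y -₃ χ u y)
      ≡⟨ 2[a+b-c]+2[a+c-b]≡a (χ u x) (χ u y) (χ x y) ⟩
    χ u x
      ∎)
    where open ≡-Reasoning

-- Degrees and edge sums

when : Bool → ℤ₃ → ℤ₃
when b x = if b then x else 0₃

when-+ : ∀ b {x y} → when b (x +₃ y) ≡ when b x +₃ when b y
when-+ true  = refl
when-+ false = refl

when≡when1* : ∀ b {x} → when b x ≡ when b 1₃ *₃ x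
when≡when1* true  = refl
when≡when1* false = refl

[ind]₃ : ∀ b → [ ind b ]₃ ≡ when b 1₃
[ind]₃ true  = refl
[ind]₃ false = refl

<ᵇ≡true⇒< : ∀ a b → (a <ᵇ b) ≡ true → a < b
<ᵇ≡true⇒< a b eq = ℕ.<ᵇ⇒< a b (Equivalence.from T-≡ eq)

<ᵇ≡false⇒≮ : ∀ a b → (a <ᵇ b) ≡ false → ¬ a < b
<ᵇ≡false⇒≮ a b eq a<b = subst T eq (ℕ.<⇒<ᵇ a<b)

module _ {n : ℕ} (G : Graph n) where

  adj⇒≢ : ∀ {u v} → adj G u v ≡ true → u ≢ v
  adj⇒≢ {u} uv refl with () ← trans (sym uv) (irrfl G u)

  neighbours : Fin n → List (Fin n)
  neighbours v = filter (λ w → T? (adj G v w)) (allFin n)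

  degree≡length-neighbours : ∀ v → degree G v ≡ length (neighbours v)
  degree≡length-neighbours v = count (allFin n)
    where
    count : ∀ ws → ℕ.sum (map (λ w → ind (adj G v w)) ws) ≡ length (filter (λ w → T? (adj G v w)) ws)
    count []       = refl
    count (w ∷ ws) with adj G v w
    ... | true  = cong ℕ.suc (count ws)
    ... | false = count ws

  neighbours-unique : ∀ v → Unique (neighbours v)
  neighbours-unique v = filter⁺ (λ w → T? (adj G v w)) (allFin⁺ n)

  ∈-neighbours⇒adj : ∀ {v w} → w ∈ neighbours v → adj G v w ≡ true
  ∈-neighbours⇒adj {v} w∈ = Equivalence.to T-≡ (proj₂ (∈-filter⁻ (λ w → T? (adj G v w)) {xs = allFin n} w∈))

  neighbour-avoiding₁ : ∀ {v} → 2 ≤ degree G v → ∀ x → ∃ λ w → adj G v w ≡ true × w ≢ x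
  neighbour-avoiding₁ {v} 2≤deg
    with neighbours v | neighbours-unique v | ∈-neighbours⇒adj {v} | degree≡length-neighbours v
  ... | w₁ ∷ w₂ ∷ _ | (w₁≢w₂ ∷ _) ∷ _ | ∈⇒adj | _ =
    avoid₁ (λ w → adj G v w ≡ true) w₁≢w₂ (∈⇒adj (here refl)) (∈⇒adj (there (here refl)))
  ... | []     | _ | _ | deg≡0 with ()    ← subst (2 ≤_) deg≡0 2≤deg
  ... | _ ∷ [] | _ | _ | deg≡1 with s≤s () ← subst (2 ≤_) deg≡1 2≤deg

  neighbour-avoiding₂ : ∀ {v} → 3 ≤ degree G v → ∀ x y → ∃ λ w → adj G v w ≡ true × w ≢ x × w ≢ y
  neighbour-avoiding₂ {v} 3≤deg
    with neighbours v | neighbours-unique v | ∈-neighbours⇒adj {v} | degree≡length-neighbours v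
  ... | w₁ ∷ w₂ ∷ w₃ ∷ _ | (w₁≢w₂ ∷ w₁≢w₃ ∷ _) ∷ (w₂≢w₃ ∷ _) ∷ _ | ∈⇒adj | _ =
    avoid₂ (λ w → adj G v w ≡ true) w₁≢w₂ w₁≢w₃ w₂≢w₃
      (∈⇒adj (here refl)) (∈⇒adj (there (here refl))) (∈⇒adj (there (there (here refl))))
  ... | []         | _ | _ | deg≡0 with ()          ← subst (3 ≤_) deg≡0 3≤deg
  ... | _ ∷ []     | _ | _ | deg≡1 with s≤s ()       ← subst (3 ≤_) deg≡1 3≤deg
  ... | _ ∷ _ ∷ [] | _ | _ | deg≡2 with s≤s (s≤s ()) ← subst (3 ≤_) deg≡2 3≤deg

  edgeSum : (Fin n → Fin n → ℤ₃) → ℤ₃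
  edgeSum c = sum λ u → sum λ v → when (toℕ u <ᵇ toℕ v) (when (adj G u v) (c u v))

  [edgeSum]₃ : (e : Fin n → Fin n → ℕ) →
    [ Σv (λ u → Σv (λ v → if toℕ u <ᵇ toℕ v then e u v else 0)) ]₃
    ≡ sum (λ u → sum (λ v → when (toℕ u <ᵇ toℕ v) [ e u v ]₃))
  [edgeSum]₃ e = trans ([Σv]₃ (λ u → Σv (λ v → if toℕ u <ᵇ toℕ v then e u v else 0)))
    (sum-cong-≗ λ u → trans ([Σv]₃ (λ v → if toℕ u <ᵇ toℕ v then e u v else 0))
      (sum-cong-≗ λ v → if-float [_]₃ (toℕ u <ᵇ toℕ v) {e u v} {0}))

  [edgeCount]₃ : [ edgeCount G ]₃ ≡ edgeSum (λ _ _ → 1₃)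
  [edgeCount]₃ = trans ([edgeSum]₃ _) (sum-cong-≗ λ u → sum-cong-≗ λ v →
    cong (when (toℕ u <ᵇ toℕ v)) ([ind]₃ (adj G u v)))

  [copyColorSum]₃ : ∀ {m} (χ : Coloring m) (φ : Fin n → Fin m) →
                    [ copyColorSum G χ φ ]₃ ≡ edgeSum (λ u v → χ (φ u) (φ v))
  [copyColorSum]₃ χ φ = trans ([edgeSum]₃ _) (sum-cong-≗ λ u → sum-cong-≗ λ v →
    cong (when (toℕ u <ᵇ toℕ v)) (trans (if-float [_]₃ (adj G u v)) (cong (when (adj G u v)) ([toℕ]₃ _))))

  [degree]₃ : ∀ u → [ degree G u ]₃ ≡ sum (λ v → when (adj G u v) 1₃)
  [degree]₃ u = trans ([Σv]₃ (λ v → ind (adj G u v))) (sum-cong-≗ λ v → [ind]₃ (adj G u v))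

  edgeSum-+ : ∀ c c′ → edgeSum (λ u v → c u v +₃ c′ u v) ≡ edgeSum c +₃ edgeSum c′
  edgeSum-+ c c′ = begin
    edgeSum (λ u v → c u v +₃ c′ u v)                ≡⟨ sum-cong-≗ (λ u → sum-cong-≗ λ v →
                                                          when²-+ (toℕ u <ᵇ toℕ v) (adj G u v)) ⟩
    sum (λ u → sum (λ v → C u v +₃ C′ u v))          ≡⟨ sum-cong-≗ (λ u → ∑-distrib-+ (C u) (C′ u)) ⟩
    sum (λ u → sum (C u) +₃ sum (C′ u))              ≡⟨ ∑-distrib-+ (sum ∘ C) (sum ∘ C′) ⟩
    sum (λ u → sum (C u)) +₃ sum (λ u → sum (C′ u))  ∎
    where
    open ≡-Reasoning
    C C′ : Fin n → Fin n → ℤ₃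
    C  u v = when (toℕ u <ᵇ toℕ v) (when (adj G u v) (c u v))
    C′ u v = when (toℕ u <ᵇ toℕ v) (when (adj G u v) (c′ u v))
    when²-+ : ∀ b b′ {x y} → when b (when b′ (x +₃ y)) ≡ when b (when b′ x) +₃ when b (when b′ y)
    when²-+ b b′ = trans (cong (when b) (when-+ b′)) (when-+ b)

  edgeSum-cong : ∀ {c c′} → (∀ u v → adj G u v ≡ true → c u v ≡ c′ u v) → edgeSum c ≡ edgeSum c′
  edgeSum-cong {c} {c′} c≡c′ =
    sum-cong-≗ λ u → sum-cong-≗ λ v → cong (when (toℕ u <ᵇ toℕ v)) (on-edge u v)
    where
    on-edge : ∀ u v → when (adj G u v) (c u v) ≡ when (adj G u v) (c′ u v)
    on-edge u v with adj G u v in uv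
    ... | true  = c≡c′ u v uv
    ... | false = refl

  private
    orient : ∀ u v x → when (toℕ u <ᵇ toℕ v) (when (adj G u v) x)
                       +₃ when (toℕ v <ᵇ toℕ u) (when (adj G v u) x) ≡ when (adj G u v) x
    orient u v x with toℕ u <ᵇ toℕ v in u<v | toℕ v <ᵇ toℕ u in v<u
    ... | true  | true  = contradiction (<ᵇ≡true⇒< (toℕ v) _ v<u) (ℕ.<-asym (<ᵇ≡true⇒< (toℕ u) _ u<v))
    ... | true  | false = +₃-identityʳ _
    ... | false | true  = cong (λ b → when b x) (Graph.sym G v u)
    ... | false | false = cong (λ b → when b x) (sym (trans (cong (adj G u) v≡u) (irrfl G u)))
      where
      v≡u : v ≡ u
      v≡u = toℕ-injective (ℕ.≤-antisym (ℕ.≮⇒≥ (<ᵇ≡false⇒≮ (toℕ u) _ u<v))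
                                       (ℕ.≮⇒≥ (<ᵇ≡false⇒≮ (toℕ v) _ v<u)))

  edgeSum-potential : ∀ (a : Fin n → ℤ₃) →
    edgeSum (λ u v → a u +₃ a v) ≡ sum (λ u → [ degree G u ]₃ *₃ a u)
  edgeSum-potential a = begin
    edgeSum (λ u v → a u +₃ a v)
      ≡⟨ edgeSum-+ (λ u _ → a u) (λ _ v → a v) ⟩
    sum (λ u → sum (X u)) +₃ sum (λ u → sum (λ v → X′ v u))
      ≡⟨ cong (sum (sum ∘ X) +₃_) (∑-comm (λ u v → X′ v u)) ⟩
    sum (λ u → sum (X u)) +₃ sum (λ u → sum (X′ u))
      ≡⟨ ∑-distrib-+ (sum ∘ X) (sum ∘ X′) ⟨
    sum (λ u → sum (X u) +₃ sum (X′ u))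
      ≡⟨ sum-cong-≗ (λ u → ∑-distrib-+ (X u) (X′ u)) ⟨
    sum (λ u → sum (λ v → X u v +₃ X′ u v))
      ≡⟨ sum-cong-≗ (λ u → sum-cong-≗ λ v → orient u v (a u)) ⟩
    sum (λ u → sum (λ v → when (adj G u v) (a u)))
      ≡⟨ sum-cong-≗ (λ u → sum-cong-≗ λ v → when≡when1* (adj G u v)) ⟩
    sum (λ u → sum (λ v → when (adj G u v) 1₃ *₃ a u))
      ≡⟨ sum-cong-≗ (λ u → *-distribʳ-sum (a u) (λ v → when (adj G u v) 1₃)) ⟨
    sum (λ u → sum (λ v → when (adj G u v) 1₃) *₃ a u)
      ≡⟨ sum-cong-≗ (λ u → cong (_*₃ a u) ([degree]₃ u)) ⟨
    sum (λ u → [ degree G u ]₃ *₃ a u)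
      ∎
    where
    open ≡-Reasoning
    X X′ : Fin n → Fin n → ℤ₃
    X  u v = when (toℕ u <ᵇ toℕ v) (when (adj G u v) (a u))
    X′ u v = when (toℕ v <ᵇ toℕ u) (when (adj G v u) (a u))

  handshake₃ : 3 ∣ edgeCount G → sum (λ u → [ degree G u ]₃) ≡ 0₃
  handshake₃ 3∣e = begin
    sum (λ u → [ degree G u ]₃)                    ≡⟨ sum-cong-≗ (λ u → *₃-identityʳ [ degree G u ]₃) ⟨
    sum (λ u → [ degree G u ]₃ *₃ 1₃)              ≡⟨ edgeSum-potential (λ _ → 1₃) ⟨
    edgeSum (λ _ _ → 1₃ +₃ 1₃)                     ≡⟨ edgeSum-+ _ _ ⟩
    edgeSum (λ _ _ → 1₃) +₃ edgeSum (λ _ _ → 1₃)  ≡⟨ cong₂ _+₃_ e≡0 e≡0 ⟩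
    0₃                                             ∎
    where
    open ≡-Reasoning
    e≡0 : edgeSum (λ _ _ → 1₃) ≡ 0₃
    e≡0 = trans (sym [edgeCount]₃) (3∣⇒[]₃≡0 3∣e)

  [copyColorSum]₃-sumColoring : ∀ {m} {χ : Coloring m} {f : Fin m → ℤ₃} {φ : Fin n → Fin m} →
    SumColoring χ f → Injective _≡_ _≡_ φ →
    [ copyColorSum G χ φ ]₃ ≡ sum (λ u → [ degree G u ]₃ *₃ f (φ u))
  [copyColorSum]₃-sumColoring {χ = χ} {f} {φ} χ≡f+f φ-injective = begin
    [ copyColorSum G χ φ ]₃                 ≡⟨ [copyColorSum]₃ χ φ ⟩
    edgeSum (λ u v → χ (φ u) (φ v))         ≡⟨ edgeSum-cong (λ u v uv →
                                                 χ≡f+f (φ u) (φ v) (adj⇒≢ uv ∘ φ-injective)) ⟩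
    edgeSum (λ u v → f (φ u) +₃ f (φ v))    ≡⟨ edgeSum-potential (f ∘ φ) ⟩
    sum (λ u → [ degree G u ]₃ *₃ f (φ u))  ∎
    where open ≡-Reasoning

-- Forests have leaves

module _ {A : Set} (_≟ᴬ_ : DecidableEquality A) (s : ℕ → A) where

  RepeatsAt : ℕ → Set
  RepeatsAt b = ∃ λ a → a < b × s a ≡ s b

  repeatsAt? : ∀ b → Dec (RepeatsAt b)
  repeatsAt? b with any? (λ (i : Fin b) → s (toℕ i) ≟ᴬ s b)
  ... | yes (i , eq) = yes (toℕ i , toℕ<n i , eq)
  ... | no ¬rep      = no λ (a , a<b , eq) →
    ¬rep (fromℕ< a<b , subst (λ x → s x ≡ s b) (sym (toℕ-fromℕ< a<b)) eq)

  first-repetition : ∀ b → RepeatsAt b →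
    ∃₂ λ a b′ → a < b′ × s a ≡ s b′ × (∀ x y → x < y → y < b′ → s x ≢ s y)
  first-repetition = <-rec _ λ b rec (a , a<b , eq) →
    case any? (λ (y : Fin b) → repeatsAt? (toℕ y)) of λ where
      (yes (y , rep)) → rec (toℕ<n y) rep
      (no none)       → a , b , a<b , eq , λ x y x<y y<b sx≡sy →
        none (fromℕ< y<b , subst RepeatsAt (sym (toℕ-fromℕ< y<b)) (x , x<y , sx≡sy))

module _ {n : ℕ} (G : Graph n) (2≤deg : ∀ v → 2 ≤ degree G v) (v₀ : Fin n) where

  private
    next : Fin n → Fin n → Fin n
    next p u = proj₁ (neighbour-avoiding₁ G (2≤deg u) p)

    -- (previous, current) vertex of a walk from v₀ that never steps straight back
    trail : ℕ → Fin n × Fin n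
    trail ℕ.zero    = v₀ , v₀
    trail (ℕ.suc k) = proj₂ (trail k) , next (proj₁ (trail k)) (proj₂ (trail k))

    walk : ℕ → Fin n
    walk k = proj₂ (trail k)

    walk-adj : ∀ k → adj G (walk k) (walk (ℕ.suc k)) ≡ true
    walk-adj k = proj₁ (proj₂ (neighbour-avoiding₁ G (2≤deg (walk k)) (proj₁ (trail k))))

    walk-nonbacktracking : ∀ k → walk (2 + k) ≢ walk k
    walk-nonbacktracking k = proj₂ (proj₂ (neighbour-avoiding₁ G (2≤deg (walk (ℕ.suc k))) (walk k)))

  -- The first repetition walk a ≡ walk b closes a cycle of length b - a, and b - a ≥ 3
  -- because the walk has no loops and does not backtrack.
  min-degree-2⇒cycle : Cycle G
  min-degree-2⇒cycle
    with i , j , i<j , wi≡wj ← pigeonhole (ℕ.n<1+n n) (λ (i : Fin (ℕ.suc n)) → walk (toℕ i))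
    with a , b , a<b , wa≡wb , window ← first-repetition _≟_ walk (toℕ j) (toℕ i , i<j , wi≡wj)
    with ℕ.m≤n⇒∃[o]m+o≡n a<b
  ... | ℕ.zero , refl =
    contradiction (trans wa≡wb (cong (walk ∘ ℕ.suc) (ℕ.+-identityʳ a))) (adj⇒≢ G (walk-adj a))
  ... | ℕ.suc ℕ.zero , refl =
    contradiction (trans (cong (walk ∘ ℕ.suc) (ℕ.+-comm 1 a)) (sym wa≡wb)) (walk-nonbacktracking a)
  ... | ℕ.suc (ℕ.suc k) , refl = record { k = k ; vs = vs ; inj = vs-inj ; step = vs-step ; close = vs-close }
    where
    vs : Fin (3 + k) → Fin n
    vs i = walk (a + toℕ i)

    inside : ∀ (i : Fin (3 + k)) → a + toℕ i < ℕ.suc a + (2 + k)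
    inside i = subst (a + toℕ i <_) (ℕ.+-suc a (2 + k)) (ℕ.+-monoʳ-< a (toℕ<n i))

    vs-inj : Injective _≡_ _≡_ vs
    vs-inj {i} {j} eq with ℕ.<-cmp (toℕ i) (toℕ j)
    ... | tri< i<j _ _ = contradiction eq (window _ _ (ℕ.+-monoʳ-< a i<j) (inside j))
    ... | tri≈ _ i≡j _ = toℕ-injective i≡j
    ... | tri> _ _ j<i = contradiction (sym eq) (window _ _ (ℕ.+-monoʳ-< a j<i) (inside i))

    vs-step : ∀ i → adj G (vs (inject₁ i)) (vs (suc i)) ≡ true
    vs-step i rewrite toℕ-inject₁ i | ℕ.+-suc a (toℕ i) = walk-adj (a + toℕ i)

    vs-close : adj G (vs (fromℕ (2 + k))) (vs zero) ≡ true
    vs-close rewrite toℕ-fromℕ (2 + k) | ℕ.+-identityʳ a =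
      subst (λ u → adj G (walk (a + (2 + k))) u ≡ true) (sym wa≡wb) (walk-adj (a + (2 + k)))

forest-leaf : ∀ {n} {F : Graph n} → IsForest F → NoIsolated F → Fin n → ∃ λ ℓ → degree F ℓ ≡ 1
forest-leaf {F = F} acyclic no-isolated v₀ with any? (λ v → degree F v ℕ.≟ 1)
... | yes leaf   = leaf
... | no no-leaf = contradiction (min-degree-2⇒cycle F 2≤deg v₀) acyclic
  where
  2≤deg : ∀ v → 2 ≤ degree F v
  2≤deg v = ℕ.≤∧≢⇒< (no-isolated v) (λ 1≡deg → no-leaf (v , sym 1≡deg))

-- Zero-sum rearrangements

Avoiding : ∀ {m} → (Fin m → Fin m → Set) → Fin m → Set
Avoiding B x = ∃₂ λ a b → a ≢ x × b ≢ x × B a b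

module _ {m : ℕ} {B : Fin m → Fin m → Set} (B? : ∀ i j → Dec (B i j))
         (B-sym : ∀ {i j} → B i j → B j i) (B-irrefl : ∀ {i} → ¬ B i i)
         (intersecting : ∀ {i j k l} → B i j → B k l → i ≢ k → i ≢ l → j ≢ k → j ≢ l → ⊥) where

  private
    avoiding? : ∀ x → Dec (Avoiding B x)
    avoiding? x = any? λ a → any? λ b → ¬? (a ≟ x) ×-dec ¬? (b ≟ x) ×-dec B? a b

    pivot : ∀ {x y} → B x y → Avoiding B x → ∃ λ z → B y z × z ≢ x
    pivot {x} {y} bxy (a , b , a≢x , b≢x , bab) with a ≟ y | b ≟ y
    ... | yes refl | _        = b , bab , b≢x
    ... | _        | yes refl = a , B-sym bab , a≢x
    ... | no a≢y   | no b≢y   =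
      contradiction bab λ bab → intersecting bxy bab (a≢x ∘ sym) (b≢x ∘ sym) (a≢y ∘ sym) (b≢y ∘ sym)

  star-or-triangle : Fin m → (∃ λ x → ¬ Avoiding B x) ⊎ (∃₂ λ x y → ∃ λ z → B x y × B y z × B x z)
  star-or-triangle x₀ with any? (λ a → any? (λ b → B? a b))
  ... | no no-pair = inj₁ (x₀ , λ (a , b , _ , _ , bab) → no-pair (a , b , bab))
  ... | yes (x , y , bxy) with avoiding? x
  ...   | no ¬avoiding-x = inj₁ (x , ¬avoiding-x)
  ...   | yes avoiding-x with pivot bxy avoiding-x
  ...     | z , byz , z≢x with avoiding? y
  ...       | no ¬avoiding-y = inj₁ (y , ¬avoiding-y)
  ...       | yes avoiding-y with pivot (B-sym bxy) avoiding-y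
  ...         | w , bxw , w≢y with w ≟ z
  ...           | yes refl = inj₂ (x , y , w , bxy , byz , bxw)
  ...           | no w≢z   = contradiction byz λ byz → intersecting bxw byz x≢y (z≢x ∘ sym) w≢y w≢z
    where
    x≢y : x ≢ y
    x≢y refl = B-irrefl bxy

ConstantOff : ∀ {m} {D : Set} → Fin m → (Fin m → D) → Set
ConstantOff x k = ∀ i j → i ≢ x → j ≢ x → k i ≡ k j

module _ {m : ℕ} {A C : Set} (g : Fin m → A) (h : Fin m → C) where

  Agree : Fin m → Fin m → Set
  Agree i j = g i ≡ g j ⊎ h i ≡ h j

  agree-off⇒constant-off : DecidableEquality A → ∀ x → (∀ i j → i ≢ x → j ≢ x → Agree i j) →
                           ConstantOff x g ⊎ ConstantOff x h
  agree-off⇒constant-off _≟ᴬ_ x agree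
    with any? (λ i → any? (λ j → ¬? (i ≟ x) ×-dec ¬? (j ≟ x) ×-dec ¬? (g i ≟ᴬ g j)))
  ... | no g-constant = inj₁ λ i j i≢x j≢x →
    decidable-stable (g i ≟ᴬ g j) λ gi≢gj → g-constant (i , j , i≢x , j≢x , gi≢gj)
  ... | yes (i , j , i≢x , j≢x , gi≢gj) = inj₂ λ k l k≢x l≢x → trans (h≡hi k k≢x) (sym (h≡hi l l≢x))
    where
    h-agree : ∀ {a b} → a ≢ x → b ≢ x → g a ≢ g b → h a ≡ h b
    h-agree a≢x b≢x ga≢gb with agree _ _ a≢x b≢x
    ... | inj₁ ga≡gb = contradiction ga≡gb ga≢gb
    ... | inj₂ ha≡hb = ha≡hb
    h≡hi : ∀ k → k ≢ x → h k ≡ h i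
    h≡hi k k≢x with g k ≟ᴬ g i
    ... | no gk≢gi  = h-agree k≢x i≢x gk≢gi
    ... | yes gk≡gi = trans (h-agree k≢x j≢x (gi≢gj ∘ trans (sym gk≡gi))) (sym (h-agree i≢x j≢x gi≢gj))

  no-common-agreement : ∀ {x y z p} → ¬ Agree x y → ¬ Agree y z → ¬ Agree x z →
                        Agree p x → Agree p y → Agree p z → ⊥
  no-common-agreement ¬xy ¬yz ¬xz (inj₁ px) (inj₁ py) _         = ¬xy (inj₁ (trans (sym px) py))
  no-common-agreement ¬xy ¬yz ¬xz (inj₂ px) (inj₂ py) _         = ¬xy (inj₂ (trans (sym px) py))
  no-common-agreement ¬xy ¬yz ¬xz (inj₁ px) (inj₂ py) (inj₁ pz) = ¬xz (inj₁ (trans (sym px) pz))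
  no-common-agreement ¬xy ¬yz ¬xz (inj₁ px) (inj₂ py) (inj₂ pz) = ¬yz (inj₂ (trans (sym py) pz))
  no-common-agreement ¬xy ¬yz ¬xz (inj₂ px) (inj₁ py) (inj₁ pz) = ¬yz (inj₁ (trans (sym py) pz))
  no-common-agreement ¬xy ¬yz ¬xz (inj₂ px) (inj₁ py) (inj₂ pz) = ¬xz (inj₂ (trans (sym px) pz))

data Diverse {m : ℕ} (W : Fin m → ℤ₃) : Set where
  two-zeros  : ∀ {i j} → i ≢ j → W i ≡ 0₃ → W j ≡ 0₃ → Diverse W
  all-values : ∀ {z o t q} → W z ≡ 0₃ → W o ≡ 1₃ → W t ≡ 2₃ → q ≢ z → q ≢ o → q ≢ t → Diverse W

module _ {m : ℕ} {W : Fin m → ℤ₃} where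

  private
    different-weights⇒≢ : ∀ {i j r s} → W i ≡ r → W j ≡ s → r ≢ s → i ≢ j
    different-weights⇒≢ Wi≡r Wj≡s r≢s refl = r≢s (trans (sym Wi≡r) Wj≡s)

  diverse-zero : Diverse W → ∃ λ z → W z ≡ 0₃
  diverse-zero (two-zeros _ Wi≡0 _)        = _ , Wi≡0
  diverse-zero (all-values Wz≡0 _ _ _ _ _) = _ , Wz≡0

  diverse-other : Diverse W → ∀ x → ∃ λ a → a ≢ x
  diverse-other (two-zeros i≢j _ _) x =
    let a , _ , a≢x = avoid₁ (λ _ → ⊤) i≢j tt tt x in a , a≢x
  diverse-other (all-values Wz Wo _ _ _ _) x =
    let a , _ , a≢x = avoid₁ (λ _ → ⊤) (different-weights⇒≢ Wz Wo λ ()) tt tt x in a , a≢x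

  diverse-constant-off : sum W ≡ 0₃ → Diverse W → ∀ x → ConstantOff x W → ∀ i → W i ≡ 0₃
  diverse-constant-off ΣW≡0 (two-zeros i≢j Wi Wj) x W-const = W≡0
    where
    W≡0-off : ∀ k → k ≢ x → W k ≡ 0₃
    W≡0-off k k≢x =
      let a , Wa , a≢x = avoid₁ (λ a → W a ≡ 0₃) i≢j Wi Wj x in trans (W-const k a k≢x a≢x) Wa
    W≡0 : ∀ k → W k ≡ 0₃
    W≡0 k with k ≟ x
    ... | yes refl = trans (sym (sum-supported₁ W x W≡0-off)) ΣW≡0
    ... | no k≢x   = W≡0-off k k≢x
  diverse-constant-off _ (all-values {z} {o} {t} Wz Wo Wt _ _ _) x W-const _ with z ≟ x | o ≟ x
  ... | yes refl | _        = contradiction (trans (sym Wo) (trans (W-const o t o≢z t≢z) Wt)) λ ()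
    where
    o≢z : o ≢ z
    o≢z = different-weights⇒≢ Wo Wz λ ()
    t≢z : t ≢ z
    t≢z = different-weights⇒≢ Wt Wz λ ()
  ... | no z≢x   | yes refl =
    contradiction (trans (sym Wz) (trans (W-const z t z≢x (different-weights⇒≢ Wt Wo λ ())) Wt)) λ ()
  ... | no z≢x   | no o≢x   = contradiction (trans (sym Wz) (trans (W-const z o z≢x o≢x) Wo)) λ ()

  diverse-fourth : Diverse W → ∀ {x y z} → W x ≢ W y → W y ≢ W z → W x ≢ W z →
                   ∃ λ p → p ≢ x × p ≢ y × p ≢ z
  diverse-fourth (all-values Wz Wo Wt q≢z q≢o q≢t) {x} {y} {z} _ _ _ =
    let p , _ , p≢x , p≢y , p≢z = avoid₃ (λ _ → ⊤)
          (different-weights⇒≢ Wz Wo λ ()) (different-weights⇒≢ Wz Wt λ ()) (q≢z ∘ sym)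
          (different-weights⇒≢ Wo Wt λ ()) (q≢o ∘ sym) (q≢t ∘ sym) tt tt tt tt x y z
    in p , p≢x , p≢y , p≢z
  diverse-fourth (two-zeros i≢j Wi Wj) {x} {y} {z} Wx≢Wy Wy≢Wz Wx≢Wz with W x ≟ 0₃ | W y ≟ 0₃
  ... | yes Wx≡0 | _        =
    let e , We≡0 , e≢x = avoid₁ (λ e → W e ≡ 0₃) i≢j Wi Wj x
    in e , e≢x , different-weights⇒≢ We≡0 refl (Wx≢Wy ∘ trans Wx≡0)
             , different-weights⇒≢ We≡0 refl (Wx≢Wz ∘ trans Wx≡0)
  ... | no Wx≢0  | yes Wy≡0 =
    let e , We≡0 , e≢y = avoid₁ (λ e → W e ≡ 0₃) i≢j Wi Wj y
    in e , different-weights⇒≢ We≡0 refl (Wx≢0 ∘ sym) , e≢y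
         , different-weights⇒≢ We≡0 refl (Wy≢Wz ∘ trans Wy≡0)
  ... | no Wx≢0  | no Wy≢0  =
    let e , We≡0 , e≢z = avoid₁ (λ e → W e ≡ 0₃) i≢j Wi Wj z
    in e , different-weights⇒≢ We≡0 refl (Wx≢0 ∘ sym) , different-weights⇒≢ We≡0 refl (Wy≢0 ∘ sym) , e≢z

module _ {m : ℕ} where

  transpose-left : ∀ (i j : Fin m) → PC.transpose i j i ≡ j
  transpose-left i j rewrite dec-true (i ≟ i) refl = refl

  transpose-right : ∀ {i j : Fin m} → i ≢ j → PC.transpose i j j ≡ i
  transpose-right {i} {j} i≢j rewrite dec-false (j ≟ i) (i≢j ∘ sym) | dec-true (j ≟ j) refl = refl

  transpose-other : ∀ {i j k : Fin m} → k ≢ i → k ≢ j → PC.transpose i j k ≡ k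
  transpose-other {i} {j} {k} k≢i k≢j rewrite dec-false (k ≟ i) k≢i | dec-false (k ≟ j) k≢j = refl

module _ {m : ℕ} (W f : Fin m → ℤ₃) where

  weightedSum : (Fin m → Fin m) → ℤ₃
  weightedSum σ = sum (λ i → W i *₃ f (σ i))

  weightedSum-transpose : ∀ σ {i j} → i ≢ j →
    weightedSum (σ ∘ PC.transpose i j) ≡ weightedSum σ -₃ (W i -₃ W j) *₃ (f (σ i) -₃ f (σ j))
  weightedSum-transpose σ {i} {j} i≢j = begin
    weightedSum (σ ∘ PC.transpose i j)                   ≡⟨ sum-cong-≗ (λ a → x≡y+[x-y] _ (g a)) ⟩
    sum (λ a → g a +₃ d a)                               ≡⟨ ∑-distrib-+ g d ⟩
    weightedSum σ +₃ sum d                               ≡⟨ cong (weightedSum σ +₃_)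
                                                              (sum-supported₂ d i≢j d-off) ⟩
    weightedSum σ +₃ (d i +₃ d j)                        ≡⟨ cong (weightedSum σ +₃_) di+dj ⟩
    weightedSum σ -₃ (W i -₃ W j) *₃ (f (σ i) -₃ f (σ j))  ∎
    where
    open ≡-Reasoning
    g d : Fin m → ℤ₃
    g a = W a *₃ f (σ a)
    d a = W a *₃ f (σ (PC.transpose i j a)) -₃ g a
    d-off : ∀ a → a ≢ i → a ≢ j → d a ≡ 0₃
    d-off a a≢i a≢j = trans (cong (λ k → W a *₃ f (σ k) -₃ g a) (transpose-other a≢i a≢j)) (x-x≡0 (g a))
    di+dj : d i +₃ d j ≡ -₃ ((W i -₃ W j) *₃ (f (σ i) -₃ f (σ j)))
    di+dj = trans (cong₂ (λ k l → (W i *₃ f (σ k) -₃ g i) +₃ (W j *₃ f (σ l) -₃ g j))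
                         (transpose-left i j) (transpose-right i≢j))
                  (transposition-gain (W i) (W j) (f (σ i)) (f (σ j)))

  private
    S₀ : ℤ₃
    S₀ = weightedSum (λ i → i)

    Δ : Fin m → Fin m → ℤ₃
    Δ i j = (W i -₃ W j) *₃ (f i -₃ f j)

    Δ≡0⇒agree : ∀ {i j} → Δ i j ≡ 0₃ → Agree W f i j
    Δ≡0⇒agree {i} {j} Δ≡0 with x*y≡0⇒x≡0⊎y≡0 (W i -₃ W j) (f i -₃ f j) Δ≡0
    ... | inj₁ ΔW≡0 = inj₁ (x-y≡0⇒x≡y (W i) (W j) ΔW≡0)
    ... | inj₂ Δf≡0 = inj₂ (x-y≡0⇒x≡y (f i) (f j) Δf≡0)

    agree⇒Δ≡0 : ∀ {i j} → Agree W f i j → Δ i j ≡ 0₃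
    agree⇒Δ≡0 {i} {j} (inj₁ Wi≡Wj) = cong (_*₃ (f i -₃ f j)) (trans (cong (_-₃ W j) Wi≡Wj) (x-x≡0 (W j)))
    agree⇒Δ≡0 {i} {j} (inj₂ fi≡fj) = trans (cong (λ a → (W i -₃ W j) *₃ (a -₃ f j)) fi≡fj)
                                           (trans (cong ((W i -₃ W j) *₃_) (x-x≡0 (f j))) (*₃-zeroʳ (W i -₃ W j)))

  module _ (ΣW≡0 : sum W ≡ 0₃) (diverse : Diverse W) where

    private
      -- Transposing a bad pair adds S₀ to the sum, so transposing two disjoint bad pairs gives 3 S₀ = 0.
      Bad : Fin m → Fin m → Set
      Bad i j = Δ i j ≡ -₃ S₀

      Bad-sym : ∀ {i j} → Bad i j → Bad j i
      Bad-sym {i} {j} = trans ([a-b]*[c-d]≡[b-a]*[d-c] (W j) (W i) (f j) (f i))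

      disagree-if-bad : S₀ ≢ 0₃ → ∀ {i j} → Bad i j → ¬ Agree W f i j
      disagree-if-bad S₀≢0 bad agree = S₀≢0 (-x≡0⇒x≡0 S₀ (trans (sym bad) (agree⇒Δ≡0 agree)))

      module NoZeroSumSwap (S₀≢0 : S₀ ≢ 0₃) (no-good : ∀ i j → Δ i j ≢ S₀)
             (no-disjoint : ∀ {i j k l} → Bad i j → Bad k l → i ≢ k → i ≢ l → j ≢ k → j ≢ l → ⊥) where

        agree-unless-bad : ∀ {p u v w} → Bad v w → p ≢ v → p ≢ w → u ≢ v → u ≢ w → Agree W f p u
        agree-unless-bad {p} {u} bvw p≢v p≢w u≢v u≢w with ≢s⇒≡0⊎≡-s S₀≢0 (no-good p u)
        ... | inj₁ Δ≡0 = Δ≡0⇒agree Δ≡0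
        ... | inj₂ bpu = contradiction bvw λ bvw → no-disjoint bpu bvw p≢v p≢w u≢v u≢w

        no-bad-triangle : ∀ {x y z} → Bad x y → Bad y z → Bad x z → ⊥
        no-bad-triangle {x} {y} {z} bxy byz bxz
          with p , p≢x , p≢y , p≢z ← diverse-fourth diverse (disagree-if-bad S₀≢0 bxy ∘ inj₁)
                                       (disagree-if-bad S₀≢0 byz ∘ inj₁) (disagree-if-bad S₀≢0 bxz ∘ inj₁) =
          no-common-agreement W f ¬xy ¬yz ¬xz
            (agree-unless-bad byz p≢y p≢z x≢y x≢z)
            (agree-unless-bad bxz p≢x p≢z (x≢y ∘ sym) y≢z)
            (agree-unless-bad bxy p≢x p≢y (x≢z ∘ sym) (y≢z ∘ sym))
          where
          ¬xy : ¬ Agree W f x y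
          ¬xy = disagree-if-bad S₀≢0 bxy
          ¬yz : ¬ Agree W f y z
          ¬yz = disagree-if-bad S₀≢0 byz
          ¬xz : ¬ Agree W f x z
          ¬xz = disagree-if-bad S₀≢0 bxz
          x≢y : x ≢ y
          x≢y refl = ¬xy (inj₁ refl)
          x≢z : x ≢ z
          x≢z refl = ¬xz (inj₁ refl)
          y≢z : y ≢ z
          y≢z refl = ¬yz (inj₁ refl)

        S₀≡Wx*[fx-fa] : ∀ {x a} → a ≢ x → ConstantOff x f → S₀ ≡ W x *₃ (f x -₃ f a)
        S₀≡Wx*[fx-fa] {x} {a} a≢x f-const = begin
          sum (λ i → W i *₃ f i)
            ≡⟨ sum-cong-≗ (λ i → w*y≡w*c+w*[y-c] (W i) (f i) c) ⟩
          sum (λ i → W i *₃ c +₃ W i *₃ (f i -₃ c))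
            ≡⟨ ∑-distrib-+ (λ i → W i *₃ c) (λ i → W i *₃ (f i -₃ c)) ⟩
          sum (λ i → W i *₃ c) +₃ sum (λ i → W i *₃ (f i -₃ c))
            ≡⟨ cong₂ _+₃_ (*-distribʳ-sum c W) (sym (sum-supported₁ _ x off-x)) ⟨
          sum W *₃ c +₃ W x *₃ (f x -₃ c)
            ≡⟨ cong (λ s → s *₃ c +₃ W x *₃ (f x -₃ c)) ΣW≡0 ⟩
          W x *₃ (f x -₃ c)
            ∎
          where
          open ≡-Reasoning
          c : ℤ₃
          c = f a
          off-x : ∀ i → i ≢ x → W i *₃ (f i -₃ c) ≡ 0₃
          off-x i i≢x = trans (cong (λ b → W i *₃ (b -₃ c)) (f-const i a i≢x a≢x))
                              (trans (cong (W i *₃_) (x-x≡0 c)) (*₃-zeroʳ (W i)))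

        agree-off-centre : ∀ {x} → ¬ Avoiding Bad x → ∀ i j → i ≢ x → j ≢ x → Agree W f i j
        agree-off-centre ¬avoiding i j i≢x j≢x with ≢s⇒≡0⊎≡-s S₀≢0 (no-good i j)
        ... | inj₁ Δ≡0 = Δ≡0⇒agree Δ≡0
        ... | inj₂ bij = contradiction (i , j , i≢x , j≢x , bij) ¬avoiding

        no-bad-star : ∀ x → ¬ Avoiding Bad x → ⊥
        no-bad-star x ¬avoiding with agree-off⇒constant-off W f _≟_ x (agree-off-centre ¬avoiding)
        ... | inj₁ W-const =
          S₀≢0 (sum-zero λ i → cong (_*₃ f i) (diverse-constant-off ΣW≡0 diverse x W-const i))
        ... | inj₂ f-const
          with a , a≢x ← diverse-other diverse x
             | z , Wz≡0 ← diverse-zero diverse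
             with z ≟ x
        ...   | yes refl = S₀≢0 (trans (S₀≡Wx*[fx-fa] a≢x f-const) (cong (_*₃ (f z -₃ f a)) Wz≡0))
        ...   | no z≢x   = no-good x z (begin
          (W x -₃ W z) *₃ (f x -₃ f z)  ≡⟨ cong₂ (λ w b → (W x -₃ w) *₃ (f x -₃ b))
                                               Wz≡0 (f-const z a z≢x a≢x) ⟩
          (W x -₃ 0₃) *₃ (f x -₃ f a)   ≡⟨ cong (_*₃ (f x -₃ f a)) (+₃-identityʳ (W x)) ⟩
          W x *₃ (f x -₃ f a)           ≡⟨ S₀≡Wx*[fx-fa] a≢x f-const ⟨
          S₀                            ∎)
          where open ≡-Reasoning

    rearrangement : ∃ λ (π : Permutation′ m) → weightedSum (π ⟨$⟩ʳ_) ≡ 0₃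
    rearrangement with S₀ ≟ 0₃
    ... | yes S₀≡0 = Perm.id , S₀≡0
    ... | no S₀≢0 with any? (λ i → any? (λ j → Δ i j ≟ S₀))
    ...   | yes (i , j , Δ≡S₀) = Perm.transpose i j , (begin
      weightedSum (PC.transpose i j)  ≡⟨ weightedSum-transpose (λ a → a) i≢j ⟩
      S₀ -₃ Δ i j                     ≡⟨ cong (λ δ → S₀ -₃ δ) Δ≡S₀ ⟩
      S₀ -₃ S₀                        ≡⟨ x-x≡0 S₀ ⟩
      0₃                              ∎)
      where
      open ≡-Reasoning
      i≢j : i ≢ j
      i≢j refl = S₀≢0 (trans (sym Δ≡S₀) (agree⇒Δ≡0 (inj₁ refl)))
    ...   | no ¬good with any? (λ i → any? λ j → any? λ k → any? λ l →
                                 Δ i j ≟ -₃ S₀ ×-dec Δ k l ≟ -₃ S₀ ×-dec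
                                 ¬? (i ≟ k) ×-dec ¬? (i ≟ l) ×-dec ¬? (j ≟ k) ×-dec ¬? (j ≟ l))
    ...     | yes (i , j , k , l , bij , bkl , i≢k , i≢l , j≢k , j≢l) =
      Perm.transpose k l ∘ₚ Perm.transpose i j , (begin
      weightedSum (τ ∘ PC.transpose k l)
        ≡⟨ weightedSum-transpose τ (≢-if-bad bkl) ⟩
      weightedSum τ -₃ (W k -₃ W l) *₃ (f (τ k) -₃ f (τ l))
        ≡⟨ cong₂ _-₃_ (weightedSum-transpose (λ a → a) (≢-if-bad bij))
                      (cong₂ (λ a b → (W k -₃ W l) *₃ (f a -₃ f b))
                             (transpose-other (i≢k ∘ sym) (j≢k ∘ sym))
                             (transpose-other (i≢l ∘ sym) (j≢l ∘ sym))) ⟩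
      S₀ -₃ Δ i j -₃ Δ k l
        ≡⟨ cong₂ (λ a b → S₀ -₃ a -₃ b) bij bkl ⟩
      S₀ -₃ -₃ S₀ -₃ -₃ S₀
        ≡⟨ x-[-x]-[-x]≡0 S₀ ⟩
      0₃
        ∎)
      where
      open ≡-Reasoning
      τ : Fin m → Fin m
      τ = PC.transpose i j
      ≢-if-bad : ∀ {a b} → Bad a b → a ≢ b
      ≢-if-bad bad refl = disagree-if-bad S₀≢0 bad (inj₁ refl)
    ...     | no ¬disjoint =
      contradiction (star-or-triangle (λ i j → Δ i j ≟ -₃ S₀) Bad-sym
                                      (λ bii → disagree-if-bad S₀≢0 bii (inj₁ refl))
                                      no-disjoint (proj₁ (diverse-zero diverse))) λ where
        (inj₁ (x , ¬avoiding))               → no-bad-star x ¬avoiding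
        (inj₂ (x , y , z , bxy , byz , bxz)) → no-bad-triangle bxy byz bxz
      where
      no-disjoint : ∀ {i j k l} → Bad i j → Bad k l → i ≢ k → i ≢ l → j ≢ k → j ≢ l → ⊥
      no-disjoint {i} {j} {k} {l} bij bkl i≢k i≢l j≢k j≢l =
        ¬disjoint (i , j , k , l , bij , bkl , i≢k , i≢l , j≢k , j≢l)
      open NoZeroSumSwap S₀≢0 (λ i j Δ≡S₀ → ¬good (i , j , Δ≡S₀)) no-disjoint

-- Zero-sum copies of forests

↑ˡ≢↑ʳ : ∀ {n t} (v : Fin n) (j : Fin t) → v ↑ˡ t ≢ n ↑ʳ j
↑ˡ≢↑ʳ {n} {t} v j eq with () ← trans (sym (splitAt-↑ˡ n v t)) (trans (cong (splitAt n) eq) (splitAt-↑ʳ n t j))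

module _ {n : ℕ} (F : Graph n) (t : ℕ) where

  weight : Fin (n + t) → ℤ₃
  weight = (λ v → [ degree F v ]₃) ++ (λ _ → 0₃)

  weight-↑ˡ : ∀ v → weight (v ↑ˡ t) ≡ [ degree F v ]₃
  weight-↑ˡ = lookup-++ˡ _ _

  weight-↑ʳ : ∀ j → weight (n ↑ʳ j) ≡ 0₃
  weight-↑ʳ = lookup-++ʳ (λ v → [ degree F v ]₃) _

  sum-weight : 3 ∣ edgeCount F → sum weight ≡ 0₃
  sum-weight 3∣e = begin
    sum weight                                                   ≡⟨ sum-splitAt n weight ⟩
    sum (λ v → weight (v ↑ˡ t)) +₃ sum (λ j → weight (n ↑ʳ j))  ≡⟨ cong₂ _+₃_ (sum-cong-≗ weight-↑ˡ)
                                                                                (sum-zero weight-↑ʳ) ⟩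
    sum (λ v → [ degree F v ]₃) +₃ 0₃                            ≡⟨ cong (_+₃ 0₃) (handshake₃ F 3∣e) ⟩
    0₃                                                           ∎
    where open ≡-Reasoning

  zero-sum-copy : ∀ {χ : Coloring (n + t)} f → SumColoring χ f →
                  (π : Permutation′ (n + t)) → weightedSum weight f (π ⟨$⟩ʳ_) ≡ 0₃ → HasZeroSumCopy F χ
  zero-sum-copy {χ} f χ≡f+f π Σ≡0 = φ , φ-injective , []₃≡⇒%3≡ (copyColorSum F χ φ) (begin
    [ copyColorSum F χ φ ]₃
      ≡⟨ [copyColorSum]₃-sumColoring F {f = f} χ≡f+f φ-injective ⟩
    sum (λ v → [ degree F v ]₃ *₃ f (φ v))
      ≡⟨ sum-cong-≗ (λ v → cong (_*₃ f (φ v)) (weight-↑ˡ v)) ⟨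
    sum (λ v → weight (v ↑ˡ t) *₃ f (φ v))
      ≡⟨ +₃-identityʳ _ ⟨
    sum (λ v → weight (v ↑ˡ t) *₃ f (φ v)) +₃ 0₃
      ≡⟨ cong (sum (λ v → weight (v ↑ˡ t) *₃ f (φ v)) +₃_)
              (sum-zero (λ j → cong (_*₃ f (π ⟨$⟩ʳ (n ↑ʳ j))) (weight-↑ʳ j))) ⟨
    sum (λ v → weight (v ↑ˡ t) *₃ f (φ v)) +₃ sum (λ j → weight (n ↑ʳ j) *₃ f (π ⟨$⟩ʳ (n ↑ʳ j)))
      ≡⟨ sum-splitAt n (λ i → weight i *₃ f (π ⟨$⟩ʳ i)) ⟨
    weightedSum weight f (π ⟨$⟩ʳ_)
      ≡⟨ Σ≡0 ⟩
    0₃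
      ∎)
    where
    open ≡-Reasoning
    φ : Fin n → Fin (n + t)
    φ v = π ⟨$⟩ʳ (v ↑ˡ t)
    φ-injective : Injective _≡_ _≡_ φ
    φ-injective = ↑ˡ-injective t _ _ ∘ Injection.injective (↔⇒↣ π)

module _ {n : ℕ} {F : Graph n} (acyclic : IsForest F) (no-isolated : NoIsolated F) where

  private
    residue : ∀ v {r} → degree F v % 3 ≡ toℕ r → [ degree F v ]₃ ≡ r
    residue v = %3≡⇒[]₃≡ (degree F v)

    residue-2 : ∀ v → degree F v % 3 ≢ 0 → degree F v % 3 ≢ 1 → [ degree F v ]₃ ≡ 2₃
    residue-2 v ≢0 ≢1 =
      ≢0≢1⇒≡2 (≢0 ∘ []₃≡⇒%3≡ (degree F v) {0₃}) (≢1 ∘ []₃≡⇒%3≡ (degree F v) {1₃})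

    other-than-unique-zero : ∀ {c v} → ¬ (∃ λ c′ → c′ ≢ c × degree F c′ % 3 ≡ 0) →
                             ¬ (v ≢ c → degree F v % 3 ≡ 1) → v ≢ c × [ degree F v ]₃ ≡ 2₃
    other-than-unique-zero {c} {v} unique ¬[v≢c→v≡1] =
      v≢c , residue-2 v (λ v≡0 → unique (v , v≢c , v≡0)) (λ v≡1 → ¬[v≢c→v≡1] (λ _ → v≡1))
      where
      v≢c : v ≢ c
      v≢c v≡c = ¬[v≢c→v≡1] (λ v≢c → contradiction v≡c v≢c)

    diverse-leaf : ∀ t {z ℓ v e} → weight F t z ≡ 0₃ → degree F ℓ ≡ 1 → [ degree F v ]₃ ≡ 2₃ →
                   e ↑ˡ t ≢ z → e ≢ ℓ → e ≢ v → Diverse (weight F t)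
    diverse-leaf t Wz deg≡1 dv e≢z e≢ℓ e≢v =
      all-values Wz (trans (weight-↑ˡ F t _) (cong [_]₃ deg≡1)) (trans (weight-↑ˡ F t _) dv)
        e≢z (e≢ℓ ∘ ↑ˡ-injective t _ _) (e≢v ∘ ↑ˡ-injective t _ _)

  diverse-of-type-1-without-zero : ¬ Type2 F → (∀ v → degree F v % 3 ≢ 0) → Diverse (weight F 1)
  diverse-of-type-1-without-zero ¬type2 no-zero
    with v , v≢1 ← ¬∀⟶∃¬ n _ (λ v → degree F v % 3 ℕ.≟ 1) (¬type2 ∘ inj₁)
    with ℓ , deg≡1 ← forest-leaf acyclic no-isolated v
    with e , ve , e≢ℓ ← neighbour-avoiding₁ F ([]₃≡2⇒2≤ (residue-2 v (no-zero v) v≢1)) ℓ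
    = diverse-leaf 1 (weight-↑ʳ F 1 zero) deg≡1 (residue-2 v (no-zero v) v≢1)
        (↑ˡ≢↑ʳ e zero) e≢ℓ (adj⇒≢ F ve ∘ sym)

  diverse-of-type-0 : ¬ Type2 F → ¬ Type1Cond F → Diverse (weight F 0)
  diverse-of-type-0 ¬type2 ¬type1
    with c , ¬c≢0 ← ¬∀⟶∃¬ n _ (λ v → ¬? (degree F v % 3 ℕ.≟ 0)) (¬type1 ∘ inj₁)
    with c≡0 ← decidable-stable (degree F c % 3 ℕ.≟ 0) ¬c≢0
    with any? (λ c′ → ¬? (c′ ≟ c) ×-dec (degree F c′ % 3 ℕ.≟ 0))
  ... | yes (c′ , c′≢c , c′≡0) =
    two-zeros (c′≢c ∘ sym ∘ ↑ˡ-injective 0 _ _)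
      (trans (weight-↑ˡ F 0 c) (residue c c≡0)) (trans (weight-↑ˡ F 0 c′) (residue c′ c′≡0))
  ... | no unique
    with v , ¬[v≢c→v≡1] ← ¬∀⟶∃¬ n _ (λ v → ¬? (v ≟ c) →-dec (degree F v % 3 ℕ.≟ 1))
                                     (λ v≢c→v≡1 → ¬type1 (inj₂ (c , c≡0 , v≢c→v≡1)))
    with v≢c , dv ← other-than-unique-zero unique ¬[v≢c→v≡1]
    with ℓ , deg≡1 ← forest-leaf acyclic no-isolated v
    with e , ce , e≢ℓ , e≢v ← neighbour-avoiding₂ F ([]₃≡0⇒3≤ (no-isolated c) (residue c c≡0)) ℓ v
    = diverse-leaf 0 (trans (weight-↑ˡ F 0 c) (residue c c≡0)) deg≡1 dv
        (adj⇒≢ F ce ∘ sym ∘ ↑ˡ-injective 0 _ _) e≢ℓ e≢v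

  diverse-of-type : ∀ τ → HasType F τ → Diverse (weight F (toℕ τ))
  diverse-of-type zero             (¬type2 , ¬type1)          = diverse-of-type-0 ¬type2 ¬type1
  diverse-of-type (suc zero)       (¬type2 , inj₁ no-zero)    = diverse-of-type-1-without-zero ¬type2 no-zero
  diverse-of-type (suc zero)       (_ , inj₂ (c , c≡0 , _))   =
    two-zeros (↑ˡ≢↑ʳ c zero) (trans (weight-↑ˡ F 1 c) (residue c c≡0)) (weight-↑ʳ F 1 zero)
  -- The two added vertices have weight 0.
  diverse-of-type (suc (suc zero)) _                          =
    two-zeros (λ eq → contradiction (↑ʳ-injective n zero (suc zero) eq) λ ())
      (weight-↑ʳ F 2 zero) (weight-↑ʳ F 2 (suc zero))

proposition4p7 : (t : Fin 3) (n : ℕ) (F : Graph n) →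
    IsForest F → 3 ∣ edgeCount F → NoIsolated F → HasType F t →
    (χ : Coloring (n + toℕ t)) → IsEdgeColoring χ → NoAlternatingC4 χ →
    HasZeroSumCopy F χ
proposition4p7 t n F acyclic 3∣e no-isolated type χ χ-sym no-alt =
  let f , χ≡f+f = sum-coloring χ-sym no-alt
      π , Σ≡0   = rearrangement (weight F (toℕ t)) f (sum-weight F (toℕ t) 3∣e)
                    (diverse-of-type acyclic no-isolated t type)
  in zero-sum-copy F (toℕ t) f χ≡f+f π Σ≡0
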